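{- For every integer $a\ge 8$, $$ g(a,a+4,a+5,a+6)=\left(2+\left\lfloor \frac{a}{6}\right\rfloor\right)a+7. $$
   Context: For positive integers $a_1,\dots,a_m$ with $\gcd(a_1,\dots,a_m)=1$, the Frobenius number $g(a_1,\dots,a_m)$ is the largest positive integer that cannot be written as $x_1a_1+\cdots+x_ma_m$ with nonnegative integers $x_i$. $\lfloor x\rfloor$ is the floor. -}

module Defs where

open import Data.Nat using (ℕ; _+_; _*_; _<_)
open import Data.List using (List; []; _∷_)
open import Data.Product using (_×_; ∃)
open import Relation.Nullary using (¬_)
open import Relation.Binary.PropositionalEquality using (_≡_)

Representable : List ℕ → ℕ → Set
Representable []       n = n ≡ 0
Representable (a ∷ as) n = ∃ λ x → ∃ λ r → (n ≡ x * a + r) × Representable as r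

IsFrobeniusNumber : List ℕ → ℕ → Set
IsFrobeniusNumber as g = ¬ Representable as g × (∀ n → g < n → Representable as n)

-- Write a sum of k generators as k·a + s. The excess s = 4y + 5z + 6w is at most 6k, is never 7,
-- and takes every value in [8, 6k]. With q = ⌊a/6⌋, (2 + q)a + 7 would need excess 7 with 2 + q
-- summands, excess a + 7 > 6(1 + q) with fewer, and is below (3 + q)a. Conversely n above it,
-- written ta + u with u < a, is t summands with excess u when u ≥ 8, and t − 1 summands with
-- excess a + u when u ≤ 7 (then t ≥ 3 + q); both excesses lie in range.
module Submission where

open import Defs
open import Data.Nat using (ℕ; zero; suc; _+_; _*_; _≤_; _<_; _/_; _%_; _≤?_; NonZero; >-nonZero; s≤s; z≤n)
open import Data.List using (List; []; _∷_)
open import Data.Nat.Properties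
open import Data.Nat.DivMod using (m≡m%n+[m/n]*n; m%n<n; m/n*n≤m)
open import Data.Nat.Tactic.RingSolver using (solve)
open import Data.Product using (_,_; _×_; ∃₂; proj₂)
open import Data.Empty using (⊥)
open import Relation.Nullary using (¬_; yes; no)
open import Relation.Binary using (tri<; tri≈; tri>)
open import Relation.Binary.PropositionalEquality

generators : ℕ → List ℕ
generators a = a ∷ (a + 4) ∷ (a + 5) ∷ (a + 6) ∷ []

-- x copies of a and y, z, w copies of a + 4, a + 5, a + 6: k summands adding up to k·a + s.
record Excess (k s : ℕ) : Set where
  constructor excess
  field
    x y z w : ℕ
    count : x + (y + z + w) ≡ k
    total : 4 * y + 5 * z + 6 * w ≡ s

excess-+ : ∀ {k s k′ s′} → Excess k s → Excess k′ s′ → Excess (k + k′) (s + s′)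
excess-+ (excess x y z w refl refl) (excess x′ y′ z′ w′ refl refl) =
  excess (x + x′) (y + y′) (z + z′) (w + w′)
    (solve (x ∷ y ∷ z ∷ w ∷ x′ ∷ y′ ∷ z′ ∷ w′ ∷ []))
    (solve (y ∷ z ∷ w ∷ y′ ∷ z′ ∷ w′ ∷ []))

excess-zero : ∀ k → Excess k 0
excess-zero k = excess k 0 0 0 (solve (k ∷ [])) refl

excess-pad : ∀ {k k′ s} → Excess k s → k ≤ k′ → Excess k′ s
excess-pad {k} {s = s} e k≤k′ with m≤n⇒∃[o]m+o≡n k≤k′
... | o , refl = subst (Excess (k + o)) (+-identityʳ s) (excess-+ e (excess-zero o))

summands-bounds : ∀ y z w →
  4 * (y + z + w) ≤ 4 * y + 5 * z + 6 * w × 4 * y + 5 * z + 6 * w ≤ 6 * (y + z + w)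
summands-bounds y z w =
  subst (4 * (y + z + w) ≤_) lower-split (m≤m+n (4 * (y + z + w)) (z + 2 * w)) ,
  subst (4 * y + 5 * z + 6 * w ≤_) upper-split (m≤m+n (4 * y + 5 * z + 6 * w) (2 * y + z))
  where
  lower-split : 4 * (y + z + w) + (z + 2 * w) ≡ 4 * y + 5 * z + 6 * w
  lower-split = solve (y ∷ z ∷ w ∷ [])
  upper-split : 4 * y + 5 * z + 6 * w + (2 * y + z) ≡ 6 * (y + z + w)
  upper-split = solve (y ∷ z ∷ w ∷ [])

excess-≤ : ∀ {k s} → Excess k s → s ≤ 6 * k
excess-≤ (excess x y z w refl refl) =
  ≤-trans (proj₂ (summands-bounds y z w)) (*-monoʳ-≤ 6 (m≤n+m (y + z + w) x))

seven-not-between : ∀ c → 4 * c ≤ 7 → 7 ≤ 6 * c → ⊥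
seven-not-between 0       _    ()
seven-not-between 1       _    7≤6 = 1+n≰n 7≤6
seven-not-between (suc (suc c)) 4c≤7 _ = 1+n≰n (≤-trans (*-monoʳ-≤ 4 (s≤s (s≤s (z≤n {c})))) 4c≤7)

¬excess-7 : ∀ {k} → ¬ Excess k 7
¬excess-7 (excess x y z w _ total) with summands-bounds y z w
... | lower , upper = seven-not-between (y + z + w) (subst (4 * (y + z + w) ≤_) total lower)
                                                    (subst (_≤ 6 * (y + z + w)) total upper)

excess-4 : Excess 1 4
excess-4 = excess 0 1 0 0 refl refl

excess-5 : Excess 1 5
excess-5 = excess 0 0 1 0 refl refl

excess-6 : Excess 1 6
excess-6 = excess 0 0 0 1 refl refl

excess-pair-pad : ∀ {k d} → Excess 2 (8 + d) → 8 + d ≤ 6 * k → Excess k (8 + d)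
excess-pair-pad {k} {d} e le = excess-pad e (*-cancelˡ-< 6 1 k (<-≤-trans (m≤m+n 7 (suc d)) le))

excess-from-8 : ∀ {k} d → 8 + d ≤ 6 * k → Excess k (8 + d)
excess-from-8 0 le = excess-pair-pad (excess-+ excess-4 excess-4) le
excess-from-8 1 le = excess-pair-pad (excess-+ excess-4 excess-5) le
excess-from-8 2 le = excess-pair-pad (excess-+ excess-5 excess-5) le
excess-from-8 3 le = excess-pair-pad (excess-+ excess-5 excess-6) le
excess-from-8 4 le = excess-pair-pad (excess-+ excess-6 excess-6) le
-- 13 − 6 = 7 is no excess, so 13 needs its own three summands.
excess-from-8 {k} 5 le = excess-pad (excess-+ excess-4 (excess-+ excess-4 excess-5)) (*-cancelˡ-< 6 2 k le)
excess-from-8 {zero}  (suc (suc (suc (suc (suc (suc d)))))) ()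
excess-from-8 {suc k} (suc (suc (suc (suc (suc (suc d)))))) le =
  excess-+ excess-6 (excess-from-8 d (+-cancelˡ-≤ 6 _ _ (subst (14 + d ≤_) (*-suc 6 k) le)))

excess-interval : ∀ {k s} → 8 ≤ s → s ≤ 6 * k → Excess k s
excess-interval 8≤s s≤6k with m≤n⇒∃[o]m+o≡n 8≤s
... | d , refl = excess-from-8 d s≤6k

excess⇒representable : ∀ {a k s} → Excess k s → Representable (generators a) (k * a + s)
excess⇒representable {a} (excess x y z w refl refl) =
  x , _ , regroup , y , _ , refl , z , _ , refl , w , 0 , refl , refl
  where
  regroup : (x + (y + z + w)) * a + (4 * y + 5 * z + 6 * w)
          ≡ x * a + (y * (a + 4) + (z * (a + 5) + (w * (a + 6) + 0)))
  regroup = solve (a ∷ x ∷ y ∷ z ∷ w ∷ [])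

representable⇒excess : ∀ {a n} → Representable (generators a) n →
  ∃₂ λ k s → Excess k s × n ≡ k * a + s
representable⇒excess {a} (x , _ , refl , y , _ , refl , z , _ , refl , w , _ , refl , refl) =
  x + (y + z + w) , 4 * y + 5 * z + 6 * w , excess x y z w refl refl , regroup
  where
  regroup : x * a + (y * (a + 4) + (z * (a + 5) + (w * (a + 6) + 0)))
          ≡ (x + (y + z + w)) * a + (4 * y + 5 * z + 6 * w)
  regroup = solve (a ∷ x ∷ y ∷ z ∷ w ∷ [])

quotient-lower-bound : ∀ {a m r t u} → m * a + r < t * a + u → u ≤ r → m < t
quotient-lower-bound {a} lt u≤r = ≰⇒> λ t≤m → <⇒≱ lt (+-mono-≤ (*-monoˡ-≤ a t≤m) u≤r)

few-summands-fall-short : ∀ {a q k s} → q * 6 ≤ a → k ≤ 1 + q → s ≤ 6 * k →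
  k * a + s < (2 + q) * a + 7
few-summands-fall-short {a} {q} {k} {s} q6≤a k≤1+q s≤6k = begin-strict
  k * a + s                    ≤⟨ +-mono-≤ (*-monoˡ-≤ a k≤1+q) (≤-trans s≤6k (*-monoʳ-≤ 6 k≤1+q)) ⟩
  (1 + q) * a + 6 * (1 + q)    ≡⟨ cong ((1 + q) * a +_) (*-comm 6 (1 + q)) ⟩
  (1 + q) * a + (6 + q * 6)    <⟨ +-monoʳ-< ((1 + q) * a) (s≤s (+-monoʳ-≤ 6 q6≤a)) ⟩
  (1 + q) * a + (7 + a)        ≡⟨ solve (a ∷ q ∷ []) ⟩
  (2 + q) * a + 7              ∎
  where open ≤-Reasoning

many-summands-overshoot : ∀ {a q k s} → 8 ≤ a → 3 + q ≤ k → (2 + q) * a + 7 < k * a + s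
many-summands-overshoot {a} {q} {k} {s} 8≤a 3+q≤k = begin-strict
  (2 + q) * a + 7    <⟨ +-monoʳ-< ((2 + q) * a) 8≤a ⟩
  (2 + q) * a + a    ≡⟨ +-comm ((2 + q) * a) a ⟩
  (3 + q) * a        ≤⟨ *-monoˡ-≤ a 3+q≤k ⟩
  k * a              ≤⟨ m≤m+n (k * a) s ⟩
  k * a + s          ∎
  where open ≤-Reasoning

frobenius-not-representable : ∀ {a q} → 8 ≤ a → q * 6 ≤ a →
  ¬ Representable (generators a) ((2 + q) * a + 7)
frobenius-not-representable {a} {q} 8≤a q6≤a rep with representable⇒excess rep
... | k , s , e , eq with <-cmp k (2 + q)
... | tri< k<2+q _ _ = <-irrefl (sym eq) (few-summands-fall-short {q = q} q6≤a (≤-pred k<2+q) (excess-≤ e))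
... | tri≈ _ refl _ = ¬excess-7 (subst (Excess k) (sym (+-cancelˡ-≡ (k * a) 7 s eq)) e)
... | tri> _ _ 2+q<k = <-irrefl eq (many-summands-overshoot {q = q} 8≤a 2+q<k)

representable-by-division : ∀ {a q} t u → 8 ≤ a → a < (1 + q) * 6 → u < a →
  (2 + q) * a + 7 < t * a + u → Representable (generators a) (t * a + u)
representable-by-division {a} {q} t u 8≤a a<6+q6 u<a F<n with u ≤? 7
... | no u≰7 = excess⇒representable (excess-interval {k = t} (≰⇒> u≰7) u≤6t)
  where
  1+q<t : 1 + q < t
  1+q<t = quotient-lower-bound (subst (_< t * a + u) regroup F<n) (≤-trans (<⇒≤ u<a) (m≤m+n a 7))
    where
    regroup : (2 + q) * a + 7 ≡ (1 + q) * a + (a + 7)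
    regroup = solve (a ∷ q ∷ [])
  u≤6t : u ≤ 6 * t
  u≤6t = ≤-trans (<⇒≤ (<-≤-trans u<a (<⇒≤ a<6+q6)))
           (≤-trans (*-monoˡ-≤ 6 (<⇒≤ 1+q<t)) (≤-reflexive (*-comm t 6)))
... | yes u≤7 = borrow t (quotient-lower-bound {m = 2 + q} F<n u≤7)
  where
  borrow : ∀ t → 3 + q ≤ t → Representable (generators a) (t * a + u)
  borrow (suc t′) (s≤s 2+q≤t′) =
    subst (Representable (generators a)) carry
      (excess⇒representable (excess-interval {k = t′} (≤-trans 8≤a (m≤m+n a u)) a+u≤6t′))
    where
    carry : t′ * a + (a + u) ≡ suc t′ * a + u
    carry = solve (a ∷ t′ ∷ u ∷ [])
    open ≤-Reasoning
    a+u≤6t′ : a + u ≤ 6 * t′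
    a+u≤6t′ = begin
      a + u                ≤⟨ +-monoʳ-≤ a u≤7 ⟩
      a + 7                ≡⟨ +-comm a 7 ⟩
      6 + suc a            ≤⟨ +-monoʳ-≤ 6 a<6+q6 ⟩
      6 + (1 + q) * 6      ≡⟨ *-comm (2 + q) 6 ⟩
      6 * (2 + q)          ≤⟨ *-monoʳ-≤ 6 2+q≤t′ ⟩
      6 * t′               ∎

above-frobenius-representable : ∀ {a q n} → 8 ≤ a → a < (1 + q) * 6 →
  (2 + q) * a + 7 < n → Representable (generators a) n
above-frobenius-representable {a} {q} {n} 8≤a a<6+q6 F<n =
  subst (Representable (generators a)) (sym division)
    (representable-by-division {q = q} (n / a) (n % a) 8≤a a<6+q6 (m%n<n n a)
      (subst ((2 + q) * a + 7 <_) division F<n))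
  where
  instance
    a≢0 : NonZero a
    a≢0 = >-nonZero (≤-trans (s≤s z≤n) 8≤a)
  division : n ≡ n / a * a + n % a
  division = trans (m≡m%n+[m/n]*n n a) (+-comm (n % a) (n / a * a))

frobenius-generators : ∀ {a q} → 8 ≤ a → q * 6 ≤ a → a < (1 + q) * 6 →
  IsFrobeniusNumber (generators a) ((2 + q) * a + 7)
frobenius-generators {q = q} 8≤a q6≤a a<6+q6 =
  frobenius-not-representable {q = q} 8≤a q6≤a , λ n → above-frobenius-representable {q = q} 8≤a a<6+q6

corollary8 : (a : ℕ) → 8 ≤ a →
    IsFrobeniusNumber (a ∷ (a + 4) ∷ (a + 5) ∷ (a + 6) ∷ []) ((2 + a / 6) * a + 7)
corollary8 a 8≤a = frobenius-generators {q = a / 6} 8≤a (m/n*n≤m a 6) a<[1+a/6]*6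
  where
  a<[1+a/6]*6 : a < (1 + a / 6) * 6
  a<[1+a/6]*6 = subst (_< (1 + a / 6) * 6) (sym (m≡m%n+[m/n]*n a 6)) (+-monoˡ-< (a / 6 * 6) (m%n<n a 6))
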